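{- Let $p$ be a prime and $n > p$ an integer, and let $\Gamma = \mathrm{Kn}(n,p)$. For each vertex $x$ of $\Gamma$ let $\vec x \in (\mathbb{Z}/p\mathbb{Z})^{V(\Gamma)}$ be the vector whose coordinate at vertex $v$ is $|x \cap v| \bmod p$. Then the $\mathbb{Z}/p\mathbb{Z}$-span of the vectors $\vec x$ ($x \in V(\Gamma)$) has dimension $n-2$ if $p \mid n$, and dimension $n-1$ otherwise.
   Context: The Kneser graph $\mathrm{Kn}(n,k)$ has as vertices the $k$-element subsets of $\{1,\dots,n\}$, two vertices being adjacent iff the subsets are disjoint. -}

module Defs where

open import Data.Nat using (ℕ; zero; suc; _+_; _*_)
open import Data.Fin using (Fin; zero; suc)
open import Data.Fin.Subset using (Subset; _∩_; ∣_∣)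
open import Data.Integer using (ℤ; +_; _-_)
import Data.Integer.Divisibility as ℤD
open import Data.List using (List; []; _∷_)
open import Data.Product using (Σ; _×_; _,_; proj₁; ∃)
open import Relation.Binary.PropositionalEquality using (_≡_)

-- Congruence modulo p on ℕ (elements of ℤ/pℤ are represented by naturals).
_≡_[mod_] : ℕ → ℕ → ℕ → Set
a ≡ b [mod p ] = (+ p) ℤD.∣ ((+ a) - (+ b))

KVertex : ℕ → ℕ → Set
KVertex n k = Σ (Subset n) (λ s → ∣ s ∣ ≡ k)

-- Vectors in (ℤ/pℤ)^{V(Kn(n,k))}, represented by ℕ-valued functions
-- (compared coordinatewise modulo p).
KVec : ℕ → ℕ → Set
KVec n k = KVertex n k → ℕ

vecOf : ∀ {n k} → KVertex n k → KVec n k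
vecOf x v = ∣ proj₁ x ∩ proj₁ v ∣

∑ : (d : ℕ) → (Fin d → ℕ) → ℕ
∑ zero f = 0
∑ (suc d) f = f zero + ∑ d (λ i → f (suc i))

combGen : ∀ {n k} → List (ℕ × KVertex n k) → KVec n k
combGen [] v = 0
combGen ((c , x) ∷ l) v = c * vecOf x v + combGen l v

InGenSpan : (p : ℕ) → ∀ {n k} → KVec n k → Set
InGenSpan p {n} {k} w =
  ∃ λ (l : List (ℕ × KVertex n k)) → ∀ v → w v ≡ combGen l v [mod p ]

combFam : ∀ {n k d} → (Fin d → ℕ) → (Fin d → KVec n k) → KVec n k
combFam {d = d} c b v = ∑ d (λ i → c i * b i v)

LinIndep : (p : ℕ) → ∀ {n k d} → (Fin d → KVec n k) → Set
LinIndep p {n} {k} {d} b =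
  (c : Fin d → ℕ) → (∀ v → combFam c b v ≡ 0 [mod p ]) → ∀ i → c i ≡ 0 [mod p ]

SpanDim : (p n k d : ℕ) → Set
SpanDim p n k d =
  Σ (Fin d → KVec n k) λ b →
    (∀ i → InGenSpan p (b i)) ×
    LinIndep p b ×
    (∀ (x : KVertex n k) → ∃ λ (c : Fin d → ℕ) →
       ∀ v → vecOf x v ≡ combFam c b v [mod p ])

-- Working mod p, write eₗ for the vector v ↦ [l ∈ v], so that x⃗ = ∑_{l ∈ x} eₗ. A weight vector a gives the vector
-- v ↦ ∑_{l ∈ v} aₗ, and this vanishes on every vertex only if a is constant mod p: as n > p there is a
-- (p−1)-set S missing any given j and k, and the vertices S ∪ {j}, S ∪ {k} force aⱼ = aₖ. The same two
-- vertices put eⱼ − eₖ in the span, and since |x| = p we have x⃗ = ∑_{l ∈ x} (eₗ − e₀), so the vectors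
-- eᵢ₊₁ − e₀ (i < n − 1) span. A relation ∑ cᵢ (eᵢ₊₁ − e₀) = 0 makes (−∑ c, c₀, c₁, …) constant, say α;
-- then every cᵢ = α and n α = 0. If p ∤ n this forces α = 0, and if p ∣ n it is the only relation, so
-- dropping e₁ − e₀ leaves a basis.

module Submission where

open import Defs
open import Data.Nat using (ℕ; _<_; _∸_)
open import Data.Nat.Divisibility using (_∣_)
open import Data.Nat.Primality using (Prime)
open import Data.Product using (_×_)
open import Relation.Nullary using (¬_)

open import Data.Nat using (zero; suc; _+_; _*_; _≤_; z≤n; s≤s)
open import Data.Nat.Properties
  using (+-comm; +-assoc; +-identityʳ; *-identityʳ; *-distribˡ-+; *-zeroʳ; +-commutativeSemigroup;
         +-monoʳ-≤; +-suc; ≤-trans; ≤-reflexive; ∸-monoˡ-≤; ∸-monoʳ-≤; module ≤-Reasoning)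
open import Data.Nat.Divisibility using (m∣m*n; ∣m∣n⇒∣m+n; ∣m⇒∣m*n; ∣-refl)
open import Data.Nat.Primality using (euclidsLemma)
open import Data.Nat.Tactic.RingSolver using (solve-∀)
open import Data.Bool using (if_then_else_)
open import Data.Fin using (Fin; zero; suc)
open import Data.Fin.Subset using (Subset; inside; outside; _∩_; _∪_; ∁; ⁅_⁆; _⊆_; _∈_; _∉_; ∣_∣)
open import Data.Fin.Subset.Properties
  using (∣⊥∣≡0; ⊆-min; out⊆; in⊆in; ∣p∣≤∣x∷p∣; ∣⁅x⁆∣≡1; x∈⁅x⁆; x∈p∪q⁺; x∈p⇒x∉∁p; ∣∁p∣≡n∸∣p∣;
         ∩-comm; ∪-identityʳ; drop-not-there)
open import Data.Vec using ([]; _∷_; lookup; here)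
open import Data.Vec.Functional using () renaming (_∷_ to _◂_)
open import Data.List using (List; []; _∷_)
open import Data.Product using (∃; _,_; proj₁)
open import Data.Sum using (_⊎_; inj₁; inj₂; [_,_]′)
open import Function using (_∘_; id; flip)
open import Relation.Nullary using (contradiction)
open import Relation.Binary.Bundles using (Setoid)
open import Relation.Binary.Structures using (IsEquivalence)
import Relation.Binary.Reasoning.Setoid as SetoidReasoning
open import Relation.Binary.PropositionalEquality using (_≡_; refl; sym; trans; cong; cong₂; subst; module ≡-Reasoning)
open import Algebra.Properties.CommutativeSemigroup +-commutativeSemigroup using (interchange)
import Data.Integer as ℤ
import Data.Integer.Properties as ℤₚ
import Data.Integer.Divisibility.Signed as ℤ∣
import Data.Integer.Tactic.RingSolver as ℤ-Solver

∑-cong : ∀ d {f g : Fin d → ℕ} → (∀ i → f i ≡ g i) → ∑ d f ≡ ∑ d g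
∑-cong zero    f≡g = refl
∑-cong (suc d) f≡g = cong₂ _+_ (f≡g zero) (∑-cong d (f≡g ∘ suc))

∑-+ : ∀ d (f g : Fin d → ℕ) → ∑ d (λ i → f i + g i) ≡ ∑ d f + ∑ d g
∑-+ zero    f g = refl
∑-+ (suc d) f g = trans (cong ((f zero + g zero) +_) (∑-+ d (f ∘ suc) (g ∘ suc)))
                        (interchange (f zero) (g zero) _ _)

∑-*ˡ : ∀ d k (f : Fin d → ℕ) → ∑ d (λ i → k * f i) ≡ k * ∑ d f
∑-*ˡ zero    k f = sym (*-zeroʳ k)
∑-*ˡ (suc d) k f = trans (cong (k * f zero +_) (∑-*ˡ d k (f ∘ suc)))
                         (sym (*-distribˡ-+ k (f zero) _))

∑-const : ∀ d k → ∑ d (λ _ → k) ≡ d * k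
∑-const zero    k = refl
∑-const (suc d) k = cong (k +_) (∑-const d k)

indicator : ∀ {n} → Subset n → Fin n → ℕ
indicator s l = if lookup s l then 1 else 0

sumOver : ∀ {n} → Subset n → (Fin n → ℕ) → ℕ
sumOver []            a = 0
sumOver (inside  ∷ s) a = a zero + sumOver s (a ∘ suc)
sumOver (outside ∷ s) a = sumOver s (a ∘ suc)

∣p∣≡∑indicator : ∀ {n} (s : Subset n) → ∣ s ∣ ≡ ∑ n (indicator s)
∣p∣≡∑indicator []            = refl
∣p∣≡∑indicator (inside  ∷ s) = cong suc (∣p∣≡∑indicator s)
∣p∣≡∑indicator (outside ∷ s) = ∣p∣≡∑indicator s

sumOver≡∑ : ∀ {n} (s : Subset n) (a : Fin n → ℕ) → sumOver s a ≡ ∑ n (λ l → indicator s l * a l)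
sumOver≡∑ []            a = refl
sumOver≡∑ (inside  ∷ s) a = cong₂ _+_ (sym (+-identityʳ (a zero))) (sumOver≡∑ s (a ∘ suc))
sumOver≡∑ (outside ∷ s) a = sumOver≡∑ s (a ∘ suc)

∣p∩q∣≡sumOver : ∀ {n} (s t : Subset n) → ∣ s ∩ t ∣ ≡ sumOver t (indicator s)
∣p∩q∣≡sumOver []            []            = refl
∣p∩q∣≡sumOver (inside  ∷ s) (inside  ∷ t) = cong suc (∣p∩q∣≡sumOver s t)
∣p∩q∣≡sumOver (outside ∷ s) (inside  ∷ t) = ∣p∩q∣≡sumOver s t
∣p∩q∣≡sumOver (inside  ∷ s) (outside ∷ t) = ∣p∩q∣≡sumOver s t
∣p∩q∣≡sumOver (outside ∷ s) (outside ∷ t) = ∣p∩q∣≡sumOver s t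

sumOver-const : ∀ {n} (s : Subset n) k → sumOver s (λ _ → k) ≡ ∣ s ∣ * k
sumOver-const []            k = refl
sumOver-const (inside  ∷ s) k = cong (k +_) (sumOver-const s k)
sumOver-const (outside ∷ s) k = sumOver-const s k

sumOver-+ : ∀ {n} (s : Subset n) (a b : Fin n → ℕ) →
            sumOver s (λ l → a l + b l) ≡ sumOver s a + sumOver s b
sumOver-+ []            a b = refl
sumOver-+ (inside  ∷ s) a b = trans (cong ((a zero + b zero) +_) (sumOver-+ s (a ∘ suc) (b ∘ suc)))
                                    (interchange (a zero) (b zero) _ _)
sumOver-+ (outside ∷ s) a b = sumOver-+ s (a ∘ suc) (b ∘ suc)

sumOver-∪⁅⁆ : ∀ {n} (s : Subset n) {j} (a : Fin n → ℕ) → j ∉ s → sumOver (s ∪ ⁅ j ⁆) a ≡ sumOver s a + a j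
sumOver-∪⁅⁆ (inside  ∷ s) {zero}  a j∉s = contradiction here j∉s
sumOver-∪⁅⁆ (outside ∷ s) {zero}  a j∉s =
  trans (cong (a zero +_) (cong (λ t → sumOver t (a ∘ suc)) (∪-identityʳ s))) (+-comm (a zero) _)
sumOver-∪⁅⁆ (inside  ∷ s) {suc j} a j∉s =
  trans (cong (a zero +_) (sumOver-∪⁅⁆ s (a ∘ suc) (drop-not-there j∉s))) (sym (+-assoc (a zero) _ _))
sumOver-∪⁅⁆ (outside ∷ s) {suc j} a j∉s = sumOver-∪⁅⁆ s (a ∘ suc) (drop-not-there j∉s)

∣p∪⁅x⁆∣≡1+∣p∣ : ∀ {n} (s : Subset n) {j} → j ∉ s → ∣ s ∪ ⁅ j ⁆ ∣ ≡ suc ∣ s ∣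
∣p∪⁅x⁆∣≡1+∣p∣ s {j} j∉s = begin
  ∣ s ∪ ⁅ j ⁆ ∣                       ≡⟨ counting (s ∪ ⁅ j ⁆) ⟩
  sumOver (s ∪ ⁅ j ⁆) (λ _ → 1)      ≡⟨ sumOver-∪⁅⁆ s (λ _ → 1) j∉s ⟩
  sumOver s (λ _ → 1) + 1            ≡⟨ cong (_+ 1) (sym (counting s)) ⟩
  ∣ s ∣ + 1                           ≡⟨ +-comm ∣ s ∣ 1 ⟩
  suc ∣ s ∣                           ∎
  where
  open ≡-Reasoning
  counting : ∀ t → ∣ t ∣ ≡ sumOver t (λ _ → 1)
  counting t = trans (sym (*-identityʳ ∣ t ∣)) (sym (sumOver-const t 1))

∣p∪⁅x⁆∩q∣ : ∀ {n} (s t : Subset n) {j} → j ∉ s → ∣ (s ∪ ⁅ j ⁆) ∩ t ∣ ≡ sumOver s (indicator t) + indicator t j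
∣p∪⁅x⁆∩q∣ s t {j} j∉s = begin
  ∣ (s ∪ ⁅ j ⁆) ∩ t ∣                ≡⟨ cong ∣_∣ (∩-comm (s ∪ ⁅ j ⁆) t) ⟩
  ∣ t ∩ (s ∪ ⁅ j ⁆) ∣                ≡⟨ ∣p∩q∣≡sumOver t (s ∪ ⁅ j ⁆) ⟩
  sumOver (s ∪ ⁅ j ⁆) (indicator t)  ≡⟨ sumOver-∪⁅⁆ s (indicator t) j∉s ⟩
  sumOver s (indicator t) + indicator t j ∎
  where open ≡-Reasoning

∣p∪q∣≤∣p∣+∣q∣ : ∀ {n} (s t : Subset n) → ∣ s ∪ t ∣ ≤ ∣ s ∣ + ∣ t ∣
∣p∪q∣≤∣p∣+∣q∣ []            []            = z≤n
∣p∪q∣≤∣p∣+∣q∣ (inside  ∷ s) (x       ∷ t) = s≤s (≤-trans (∣p∪q∣≤∣p∣+∣q∣ s t) (+-monoʳ-≤ ∣ s ∣ (∣p∣≤∣x∷p∣ x t)))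
∣p∪q∣≤∣p∣+∣q∣ (outside ∷ s) (inside  ∷ t) = ≤-trans (s≤s (∣p∪q∣≤∣p∣+∣q∣ s t)) (≤-reflexive (sym (+-suc ∣ s ∣ ∣ t ∣)))
∣p∪q∣≤∣p∣+∣q∣ (outside ∷ s) (outside ∷ t) = ∣p∪q∣≤∣p∣+∣q∣ s t

⊆-ofSize : ∀ {n} r (t : Subset n) → r ≤ ∣ t ∣ → ∃ λ s → s ⊆ t × ∣ s ∣ ≡ r
⊆-ofSize {n} zero    t             _           = _ , ⊆-min t , ∣⊥∣≡0 n
⊆-ofSize     (suc r) (outside ∷ t) r<∣t∣       with ⊆-ofSize (suc r) t r<∣t∣
... | s , s⊆t , ∣s∣≡r = outside ∷ s , out⊆ s⊆t , ∣s∣≡r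
⊆-ofSize     (suc r) (inside  ∷ t) (s≤s r≤∣t∣) with ⊆-ofSize r t r≤∣t∣
... | s , s⊆t , ∣s∣≡r = inside ∷ s , in⊆in s⊆t , cong suc ∣s∣≡r

avoidingPair : ∀ {n} r → 2 + r ≤ n → (j k : Fin n) → ∃ λ s → ∣ s ∣ ≡ r × j ∉ s × k ∉ s
avoidingPair {n} r 2+r≤n j k = avoiding (⊆-ofSize r (∁ forbidden) r≤∣∁forbidden∣)
  where
  forbidden : Subset n
  forbidden = ⁅ j ⁆ ∪ ⁅ k ⁆

  ∣forbidden∣≤2 : ∣ forbidden ∣ ≤ 2
  ∣forbidden∣≤2 = ≤-trans (∣p∪q∣≤∣p∣+∣q∣ ⁅ j ⁆ ⁅ k ⁆) (≤-reflexive (cong₂ _+_ (∣⁅x⁆∣≡1 j) (∣⁅x⁆∣≡1 k)))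

  r≤∣∁forbidden∣ : r ≤ ∣ ∁ forbidden ∣
  r≤∣∁forbidden∣ = begin
    r                    ≤⟨ ∸-monoˡ-≤ 2 2+r≤n ⟩
    n ∸ 2                ≤⟨ ∸-monoʳ-≤ n ∣forbidden∣≤2 ⟩
    n ∸ ∣ forbidden ∣    ≡⟨ sym (∣∁p∣≡n∸∣p∣ forbidden) ⟩
    ∣ ∁ forbidden ∣      ∎
    where open ≤-Reasoning

  avoiding : (∃ λ s → s ⊆ ∁ forbidden × ∣ s ∣ ≡ r) → ∃ λ s → ∣ s ∣ ≡ r × j ∉ s × k ∉ s
  avoiding (s , s⊆∁forbidden , ∣s∣≡r) = s , ∣s∣≡r , notIn (inj₁ (x∈⁅x⁆ j)) , notIn (inj₂ (x∈⁅x⁆ k))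
    where
    notIn : ∀ {i} → i ∈ ⁅ j ⁆ ⊎ i ∈ ⁅ k ⁆ → i ∉ s
    notIn i∈forbidden i∈s = x∈p⇒x∉∁p (x∈p∪q⁺ i∈forbidden) (s⊆∁forbidden i∈s)

module Modular (p : ℕ) where
  open ℤ using (+_)

  -- A record rather than a synonym of _≡_[mod_], so that a and b can be inferred from a ≈ b.
  infix 4 _≈_
  record _≈_ (a b : ℕ) : Set where
    constructor mod
    field unmod : a ≡ b [mod p ]
  open _≈_ public

  private
    -- Signed divisibility has the algebra that the unsigned one used in Defs lacks.
    toSigned : ∀ {a b} → a ≈ b → + p ℤ∣.∣ + a ℤ.- + b
    toSigned (mod a≡b) = ℤ∣.∣ᵤ⇒∣ a≡b

    fromSigned : ∀ {a b} → + p ℤ∣.∣ + a ℤ.- + b → a ≈ b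
    fromSigned p∣a-b = mod (ℤ∣.∣⇒∣ᵤ p∣a-b)

    via : ∀ {x a b} → x ≡ + a ℤ.- + b → + p ℤ∣.∣ x → a ≈ b
    via refl = fromSigned

  ∣⇒≈0 : ∀ {a} → p ∣ a → a ≈ 0
  ∣⇒≈0 {a} p∣a = mod (subst (p ∣_) (sym (+-identityʳ a)) p∣a)

  ≈0⇒∣ : ∀ {a} → a ≈ 0 → p ∣ a
  ≈0⇒∣ {a} (mod a≡0) = subst (p ∣_) (+-identityʳ a) a≡0

  ≈-refl : ∀ {a} → a ≈ a
  ≈-refl {a} = via (sym (ℤₚ.+-inverseʳ (+ a))) (ℤ∣.divides (+ 0) refl)

  ≈-reflexive : ∀ {a b} → a ≡ b → a ≈ b
  ≈-reflexive refl = ≈-refl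

  ≈-sym : ∀ {a b} → a ≈ b → b ≈ a
  ≈-sym {a} {b} a≈b = via (negate (+ a) (+ b)) (ℤ∣.∣m⇒∣-m (toSigned a≈b))
    where
    negate : ∀ x y → ℤ.- (x ℤ.- y) ≡ y ℤ.- x
    negate = ℤ-Solver.solve-∀

  ≈-trans : ∀ {a b c} → a ≈ b → b ≈ c → a ≈ c
  ≈-trans {a} {b} {c} a≈b b≈c =
    via (telescope (+ a) (+ b) (+ c)) (ℤ∣.∣m∣n⇒∣m+n (toSigned a≈b) (toSigned b≈c))
    where
    telescope : ∀ x y z → (x ℤ.- y) ℤ.+ (y ℤ.- z) ≡ x ℤ.- z
    telescope = ℤ-Solver.solve-∀

  +-cong : ∀ {a b c d} → a ≈ b → c ≈ d → a + c ≈ b + d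
  +-cong {a} {b} {c} {d} a≈b c≈d =
    via (regroup (+ a) (+ b) (+ c) (+ d)) (ℤ∣.∣m∣n⇒∣m+n (toSigned a≈b) (toSigned c≈d))
    where
    regroup : ∀ x y z w → (x ℤ.- y) ℤ.+ (z ℤ.- w) ≡ (x ℤ.+ z) ℤ.- (y ℤ.+ w)
    regroup = ℤ-Solver.solve-∀

  +-cancelˡ : ∀ t {a b} → t + a ≈ t + b → a ≈ b
  +-cancelˡ t {a} {b} t+a≈t+b = via (cancel (+ t) (+ a) (+ b)) (toSigned t+a≈t+b)
    where
    cancel : ∀ x y z → (x ℤ.+ y) ℤ.- (x ℤ.+ z) ≡ y ℤ.- z
    cancel = ℤ-Solver.solve-∀

  sumOver-cong-≈ : ∀ {n} (s : Subset n) {a b : Fin n → ℕ} → (∀ l → a l ≈ b l) → sumOver s a ≈ sumOver s b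
  sumOver-cong-≈ []            a≈b = ≈-refl
  sumOver-cong-≈ (inside  ∷ s) a≈b = +-cong (a≈b zero) (sumOver-cong-≈ s (a≈b ∘ suc))
  sumOver-cong-≈ (outside ∷ s) a≈b = sumOver-cong-≈ s (a≈b ∘ suc)

  x+p*k≈x : ∀ x k → x + p * k ≈ x
  x+p*k≈x x k = ≈-trans (+-cong ≈-refl (∣⇒≈0 (m∣m*n k))) (≈-reflexive (+-identityʳ x))

  ≈-isEquivalence : IsEquivalence _≈_
  ≈-isEquivalence = record { refl = ≈-refl ; sym = ≈-sym ; trans = ≈-trans }

  ≈-setoid : Setoid _ _
  ≈-setoid = record { isEquivalence = ≈-isEquivalence }

  ∑-cong-≈ : ∀ d {f g : Fin d → ℕ} → (∀ i → f i ≈ g i) → ∑ d f ≈ ∑ d g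
  ∑-cong-≈ zero    f≈g = ≈-refl
  ∑-cong-≈ (suc d) f≈g = +-cong (f≈g zero) (∑-cong-≈ d (f≈g ∘ suc))

module KneserSpan (q : ℕ) where
  p : ℕ
  p = suc q

  open Modular p

  adjoin : ∀ {n} (s : Subset n) → ∣ s ∣ ≡ q → ∀ j → j ∉ s → KVertex n p
  adjoin s ∣s∣≡q j j∉s = s ∪ ⁅ j ⁆ , trans (∣p∪⁅x⁆∣≡1+∣p∣ s j∉s) (cong suc ∣s∣≡q)

  -- e_j − e_o, where e_l(v) = [l ∈ v]; the coefficient q stands for −1.
  difference : ∀ {n} → Fin n → Fin n → KVec n p
  difference j o (w , _) = indicator w j + q * indicator w o

  difference∈span : ∀ {n} → p < n → (j o : Fin n) → InGenSpan p (difference j o)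
  difference∈span p<n j o with avoidingPair q p<n j o
  ... | s , ∣s∣≡q , j∉s , o∉s = generators , λ v → unmod (combination v)
    where
    generators : List (ℕ × KVertex _ p)
    generators = (1 , adjoin s ∣s∣≡q j j∉s) ∷ (q , adjoin s ∣s∣≡q o o∉s) ∷ []

    combination : ∀ v → difference j o v ≈ combGen generators v
    combination v@(w , _) = begin
      indicator w j + q * indicator w o                         ≈⟨ ≈-sym (x+p*k≈x _ A) ⟩
      indicator w j + q * indicator w o + p * A                 ≡⟨ rearrange q (indicator w j) (indicator w o) A ⟩
      1 * (A + indicator w j) + (q * (A + indicator w o) + 0)   ≡⟨ sym (cong₂ (λ a b → 1 * a + (q * b + 0))
                                                                         (∣p∪⁅x⁆∩q∣ s w j∉s) (∣p∪⁅x⁆∩q∣ s w o∉s)) ⟩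
      combGen generators v                                      ∎
      where
      open SetoidReasoning ≈-setoid
      A : ℕ
      A = sumOver s (indicator w)
      rearrange : ∀ q a b A → a + q * b + suc q * A ≡ 1 * (A + a) + (q * (A + b) + 0)
      rearrange = solve-∀

  vanishing⇒constant : ∀ {n} → p < n → (a : Fin n → ℕ) → (∀ (v : KVertex n p) → sumOver (proj₁ v) a ≈ 0) →
                       ∀ j k → a j ≈ a k
  vanishing⇒constant p<n a vanishes j k with avoidingPair q p<n j k
  ... | s , ∣s∣≡q , j∉s , k∉s = +-cancelˡ (sumOver s a) (≈-trans (vanishesWith j∉s) (≈-sym (vanishesWith k∉s)))
    where
    vanishesWith : ∀ {i} → i ∉ s → sumOver s a + a i ≈ 0
    vanishesWith i∉s = subst (_≈ 0) (sumOver-∪⁅⁆ s a i∉s) (vanishes (adjoin s ∣s∣≡q _ i∉s))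

  basis : ∀ {N} → Fin N → KVec (suc N) p
  basis i = difference (suc i) zero

  -- The coordinates of ∑ᵢ cᵢ (e_{i+1} − e₀).
  combCoeffs : ∀ {N} → (Fin N → ℕ) → Fin (suc N) → ℕ
  combCoeffs {N} c zero    = q * ∑ N c
  combCoeffs     c (suc i) = c i

  ∑-combCoeffs : ∀ {N} (c : Fin N → ℕ) → ∑ (suc N) (combCoeffs c) ≡ p * ∑ N c
  ∑-combCoeffs {N} c = +-comm (q * ∑ N c) (∑ N c)

  combFam-basis : ∀ {N} (c : Fin N → ℕ) (v : KVertex (suc N) p) →
                  combFam c basis v ≡ sumOver (proj₁ v) (combCoeffs c)
  combFam-basis {N} c (w , _) = begin
    ∑ N (λ i → c i * (e (suc i) + q * e zero))
      ≡⟨ ∑-cong N (λ i → distribute (c i) (e (suc i)) (e zero) q) ⟩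
    ∑ N (λ i → e zero * (q * c i) + e (suc i) * c i)
      ≡⟨ ∑-+ N _ _ ⟩
    ∑ N (λ i → e zero * (q * c i)) + ∑ N (λ i → e (suc i) * c i)
      ≡⟨ cong (_+ ∑ N (λ i → e (suc i) * c i)) (trans (∑-*ˡ N (e zero) _) (cong (e zero *_) (∑-*ˡ N q c))) ⟩
    ∑ (suc N) (λ l → e l * combCoeffs c l)
      ≡⟨ sym (sumOver≡∑ w (combCoeffs c)) ⟩
    sumOver w (combCoeffs c)
      ∎
    where
    open ≡-Reasoning
    e : Fin (suc N) → ℕ
    e = indicator w
    distribute : ∀ c a b q → c * (a + q * b) ≡ b * (q * c) + a * c
    distribute = solve-∀

  tail≈⇒≈combCoeffs : ∀ {N} (f : Fin (suc N) → ℕ) (c : Fin N → ℕ) → (∀ i → f (suc i) ≈ c i) →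
                      ∑ (suc N) f ≈ 0 → ∀ l → f l ≈ combCoeffs c l
  tail≈⇒≈combCoeffs {N} f c tail sum≈0 zero = +-cancelˡ (∑ N c) (begin
    ∑ N c + f zero              ≈⟨ +-cong (∑-cong-≈ N (≈-sym ∘ tail)) ≈-refl ⟩
    ∑ N (f ∘ suc) + f zero      ≡⟨ +-comm _ (f zero) ⟩
    ∑ (suc N) f                 ≈⟨ sum≈0 ⟩
    0                           ≈⟨ ≈-sym (∣⇒≈0 (m∣m*n (∑ N c))) ⟩
    p * ∑ N c                   ∎)
    where open SetoidReasoning ≈-setoid
  tail≈⇒≈combCoeffs f c tail sum≈0 (suc i) = tail i

  sumOver≈combFam : ∀ {N} (f : Fin (suc N) → ℕ) (c : Fin N → ℕ) → (∀ i → f (suc i) ≈ c i) →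
                    ∑ (suc N) f ≈ 0 → ∀ v → sumOver (proj₁ v) f ≈ combFam c basis v
  sumOver≈combFam f c tail sum≈0 v =
    ≈-trans (sumOver-cong-≈ (proj₁ v) (tail≈⇒≈combCoeffs f c tail sum≈0)) (≈-reflexive (sym (combFam-basis c v)))

  combFam-vanishing⇒constant : ∀ {N} → p < suc N → (c : Fin N → ℕ) →
                               (∀ v → combFam c basis v ≡ 0 [mod p ]) → ∀ j k → combCoeffs c j ≈ combCoeffs c k
  combFam-vanishing⇒constant p<n c vanishes =
    vanishing⇒constant p<n (combCoeffs c) (λ v → subst (_≈ 0) (combFam-basis c v) (mod (vanishes v)))

  basis-independent : ∀ {N} → Prime p → p < suc N → ¬ p ∣ suc N → LinIndep p (basis {N})
  basis-independent {N} pr p<n p∤n c vanishes i = unmod (≈-trans (constant (suc i) zero) α≈0)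
    where
    open SetoidReasoning ≈-setoid
    constant : ∀ j k → combCoeffs c j ≈ combCoeffs c k
    constant = combFam-vanishing⇒constant p<n c vanishes

    α : ℕ
    α = combCoeffs c zero

    nα≈0 : suc N * α ≈ 0
    nα≈0 = begin
      suc N * α                 ≡⟨ sym (∑-const (suc N) α) ⟩
      ∑ (suc N) (λ _ → α)       ≈⟨ ∑-cong-≈ (suc N) (λ l → ≈-sym (constant l zero)) ⟩
      ∑ (suc N) (combCoeffs c)  ≡⟨ ∑-combCoeffs c ⟩
      p * ∑ N c                 ≈⟨ ∣⇒≈0 (m∣m*n (∑ N c)) ⟩
      0                         ∎

    α≈0 : α ≈ 0
    α≈0 = ∣⇒≈0 ([ flip contradiction p∤n , id ]′ (euclidsLemma (suc N) α pr (≈0⇒∣ nα≈0)))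

  tail-independent : ∀ {m} → p < suc (suc m) → LinIndep p (basis {suc m} ∘ suc)
  tail-independent p<n c vanishes i =
    unmod (combFam-vanishing⇒constant p<n (0 ◂ c) vanishes (suc (suc i)) (suc zero))

  basis-spans : ∀ {N} (x : KVertex (suc N) p) → ∃ λ c → ∀ v → vecOf x v ≡ combFam c basis v [mod p ]
  basis-spans (s , ∣s∣≡p) = indicator s ∘ suc , λ v →
    unmod (≈-trans (≈-reflexive (∣p∩q∣≡sumOver s (proj₁ v)))
                   (sumOver≈combFam (indicator s) _ (λ _ → ≈-refl) ∑≈0 v))
    where
    ∑≈0 : ∑ _ (indicator s) ≈ 0
    ∑≈0 = subst (_≈ 0) (trans (sym ∣s∣≡p) (∣p∣≡∑indicator s)) (∣⇒≈0 ∣-refl)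

  tail-spans : ∀ {m} → p ∣ suc (suc m) → (x : KVertex (suc (suc m)) p) →
               ∃ λ c → ∀ v → vecOf x v ≡ combFam c (basis ∘ suc) v [mod p ]
  tail-spans {m} p∣n (s , ∣s∣≡p) =
    c , λ v → unmod (≈-trans (vecOf≈ v) (sumOver≈combFam f (0 ◂ c) tail ∑f≈0 v))
    where
    open SetoidReasoning ≈-setoid
    n : ℕ
    n = suc (suc m)

    x₁ : ℕ
    x₁ = indicator s (suc zero)

    -- The indicator of x shifted by −x₁, which gives the same vector since every vertex has p elements.
    f : Fin n → ℕ
    f l = indicator s l + q * x₁

    c : Fin m → ℕ
    c i = f (suc (suc i))

    tail : ∀ i → f (suc i) ≈ (0 ◂ c) i
    tail zero    = ∣⇒≈0 (m∣m*n x₁)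
    tail (suc i) = ≈-refl

    ∑f≈0 : ∑ n f ≈ 0
    ∑f≈0 = begin
      ∑ n f                                   ≡⟨ ∑-+ n (indicator s) (λ _ → q * x₁) ⟩
      ∑ n (indicator s) + ∑ n (λ _ → q * x₁)  ≡⟨ cong₂ _+_ (trans (sym (∣p∣≡∑indicator s)) ∣s∣≡p) (∑-const n (q * x₁)) ⟩
      p + n * (q * x₁)                        ≈⟨ ∣⇒≈0 (∣m∣n⇒∣m+n ∣-refl (∣m⇒∣m*n (q * x₁) p∣n)) ⟩
      0                                       ∎

    vecOf≈ : ∀ v → vecOf (s , ∣s∣≡p) v ≈ sumOver (proj₁ v) f
    vecOf≈ (w , ∣w∣≡p) = begin
      ∣ s ∩ w ∣                                   ≡⟨ ∣p∩q∣≡sumOver s w ⟩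
      sumOver w (indicator s)                     ≈⟨ ≈-sym (x+p*k≈x _ (q * x₁)) ⟩
      sumOver w (indicator s) + p * (q * x₁)      ≡⟨ cong (λ k → sumOver w (indicator s) + k * (q * x₁)) (sym ∣w∣≡p) ⟩
      sumOver w (indicator s) + ∣ w ∣ * (q * x₁)  ≡⟨ sym (trans (sumOver-+ w (indicator s) (λ _ → q * x₁))
                                                              (cong (sumOver w (indicator s) +_) (sumOver-const w (q * x₁)))) ⟩
      sumOver w f                                 ∎

  dimension-∤ : ∀ {N} → Prime p → p < suc N → ¬ p ∣ suc N → SpanDim p (suc N) p N
  dimension-∤ pr p<n p∤n =
    basis , (λ i → difference∈span p<n (suc i) zero) , basis-independent pr p<n p∤n , basis-spans

  dimension-∣ : ∀ {m} → p < suc (suc m) → p ∣ suc (suc m) → SpanDim p (suc (suc m)) p m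
  dimension-∣ p<n p∣n =
    basis ∘ suc , (λ i → difference∈span p<n (suc (suc i)) zero) , tail-independent p<n , tail-spans p∣n

mainTheorem3 : (p n : ℕ) → Prime p → p < n →
    (p ∣ n → SpanDim p n p (n ∸ 2)) × (¬ (p ∣ n) → SpanDim p n p (n ∸ 1))
mainTheorem3 zero    _             () _
mainTheorem3 (suc q) zero          _  ()
mainTheorem3 (suc q) (suc zero)    _  (s≤s ())
mainTheorem3 (suc q) (suc (suc m)) pr p<n = dimension-∣ p<n , dimension-∤ pr p<n
  where open KneserSpan q
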